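{- Let $(a,b,c,r,s;x_1,y_1,\dots,x_N,y_N)$ be a set of solutions in basic form with $x_1=y_2=0$, $x_i>0$ for all $i>1$, $y_1>0$, $y_i>0$ for all $i>2$, such that no two of $x_2,\dots,x_N$ are equal and no two of $y_1,y_3,y_4,\dots,y_N$ are equal. Then $x_2=\min(x_2,x_3,\dots,x_N)$ and $y_1=\min(y_1,y_3,y_4,\dots,y_N)$, except when the set or its associate is $(3,2,7,1,2;0,2,2,0,1,1)$.
   Context: For integers $a>1$, $b>1$, $c>0$, $r>0$, $s>0$, a solution of $(-1)^u r a^x + (-1)^v s b^y = c$ is a quadruple $(x,y,u,v)$ with $x,y$ nonnegative integers and $u,v\in\{0,1\}$; it is referred to by the pair $(x,y)$. A set of solutions $(a,b,c,r,s;x_1,y_1,\dots,x_N,y_N)$ is the set of $N>2$ distinct pairs $(x_i,y_i)$, each a solution for the given $a,b,c,r,s$. It is in basic form if $\gcd(r,sb)=\gcd(s,ra)=1$, $\min_i x_i=\min_i y_i=0$, and neither $a$ nor $b$ is a perfect power. The associate of $(a,b,c,r,s;x_1,y_1,\dots,x_N,y_N)$ is $(b,a,c,s,r;y_1,x_1,\dots,y_N,x_N)$. -}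

module Defs where

open import Data.Nat as ℕ using (ℕ; zero; suc; _≤_; _<_; _^_)
open import Data.Nat.GCD using (gcd)
open import Data.Integer as ℤ using (ℤ; +_)
open import Data.Bool using (Bool; true; false)
open import Data.Fin using (Fin)
open import Data.Product using (Σ; ∃; _×_; _,_)
open import Data.Sum using (_⊎_)
open import Relation.Binary.PropositionalEquality using (_≡_; _≢_)
open import Relation.Nullary using (¬_)

-- (-1)^u as an integer; u = false means 0, u = true means 1
sgn : Bool → ℤ
sgn false = + 1
sgn true  = ℤ.- (+ 1)

IsSolution : (a b c r s x y : ℕ) → Set
IsSolution a b c r s x y =
  Σ Bool λ u → Σ Bool λ v →
    sgn u ℤ.* (+ (r ℕ.* a ^ x)) ℤ.+ sgn v ℤ.* (+ (s ℕ.* b ^ y)) ≡ + c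

PerfectPower : ℕ → Set
PerfectPower n = Σ ℕ λ m → Σ ℕ λ k → 2 ≤ k × n ≡ m ^ k

-- a set of solutions (a,b,c,r,s; x_1,y_1,...,x_N,y_N), indices 1..N rendered as Fin N
record SolutionSet (a b c r s N : ℕ) (x y : Fin N → ℕ) : Set where
  field
    a>1 : 1 < a
    b>1 : 1 < b
    c>0 : 0 < c
    r>0 : 0 < r
    s>0 : 0 < s
    N>2 : 2 < N
    solutions : ∀ i → IsSolution a b c r s (x i) (y i)
    distinct  : ∀ i j → x i ≡ x j → y i ≡ y j → i ≡ j

record BasicForm (a b c r s N : ℕ) (x y : Fin N → ℕ) : Set where
  field
    gcd-r-sb : gcd r (s ℕ.* b) ≡ 1
    gcd-s-ra : gcd s (r ℕ.* a) ≡ 1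
    -- min_i x_i = 0 (for naturals: some x_i is 0), likewise for y
    min-x    : ∃ λ i → x i ≡ 0
    min-y    : ∃ λ j → y j ≡ 0
    a-not-pp : ¬ PerfectPower a
    b-not-pp : ¬ PerfectPower b

-- the pair set {(0,2),(2,0),(1,1)}: the pairs of (3,2,7,1,2;0,2,2,0,1,1),
-- which (as a set of pairs) coincides with the pairs of its associate
-- (2,3,7,2,1;2,0,0,2,1,1)
InExceptionalPairs : ℕ → ℕ → Set
InExceptionalPairs x y = (x ≡ 0 × y ≡ 2) ⊎ (x ≡ 2 × y ≡ 0) ⊎ (x ≡ 1 × y ≡ 1)

Exceptional : (a b c r s N : ℕ) (x y : Fin N → ℕ) → Set
Exceptional a b c r s N x y =
  ((a ≡ 3 × b ≡ 2 × c ≡ 7 × r ≡ 1 × s ≡ 2) ⊎ (a ≡ 2 × b ≡ 3 × c ≡ 7 × r ≡ 2 × s ≡ 1))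
  × N ≡ 3
  × (∀ i → InExceptionalPairs (x i) (y i))
  × (∀ p q → InExceptionalPairs p q → ∃ λ i → x i ≡ p × y i ≡ q)

{-# OPTIONS --safe #-}
module Submission where

-- Suppose x_i < x_2 for some i > 2; the case y_i < y_1 is the same one for the associate.
-- Put u = a^{x_i}, A = a^{x_2} = u k, v = b^{y_i} and B = b^{y_1}. Subtracting the equations
-- of the solutions (0, y_1), (x_2, 0), (x_i, y_i) pairwise gives relations r (P ± P′) = s (Q ± Q′)
-- between 1, u, A and 1, v, B. As r and s are coprime and prime to b and a respectively, these
-- relations become divisibilities which force u ≤ 5, A ≤ 10, v ≤ 24, B ≤ 15 and r, s ≤ 3, and a
-- finite search leaves only the solutions (0,2), (2,0), (1,1) of (3,2,7,1,2) or of its associate.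
-- No further solution exists there, because 3^m ± 2^{n+1} ≠ ±7 for m, n ≥ 3: modulo 8, modulo 3,
-- and in the one remaining case, 7 = Q² − P² with P = 3^{m/2}.

open import Defs
open import Data.Bool using (Bool; true; false; not)
open import Data.Empty using (⊥; ⊥-elim)
open import Data.Fin as Fin using (Fin; zero; suc)
import Data.Fin.Properties as Fin
open import Data.Integer as ℤ using (ℤ)
import Data.Integer.Properties as ℤ
open import Data.Integer.Tactic.RingSolver as ℤ-Solver using ()
open import Data.Nat as ℕ
  using (ℕ; zero; suc; _+_; _*_; _^_; _∸_; _%_; _≤_; _<_; _≤?_; _<?_; z≤n; s≤s; s≤s⁻¹; NonZero; >-nonZero)
open import Data.Nat.Coprimality as Coprime using (Coprime; coprime-divisor; gcd≡1⇒coprime)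
open import Data.Nat.DivMod using (%-distribˡ-+; %-distribˡ-*; m*n%n≡0)
open import Data.Nat.Divisibility
open import Data.Nat.Properties
open import Data.Nat.Tactic.RingSolver using (solve-∀)
open import Data.Product using (Σ; ∃; _×_; _,_)
open import Data.Sum using (_⊎_; inj₁; inj₂)
open import Relation.Binary.PropositionalEquality
open import Relation.Nullary using (Dec; yes; no; ¬_; ¬?; contradiction)
open import Relation.Nullary.Decidable using (_×-dec_; _⊎-dec_; _→-dec_; toWitness)

SumOrDiff : ℕ → ℕ → ℕ → Set
SumOrDiff k P Q = k ≡ P + Q ⊎ k + Q ≡ P ⊎ k + P ≡ Q

SumOrDiff-sym : ∀ {k P Q} → SumOrDiff k P Q → SumOrDiff k Q P
SumOrDiff-sym {k} {P} {Q} (inj₁ k≡P+Q) = inj₁ (trans k≡P+Q (+-comm P Q))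
SumOrDiff-sym (inj₂ (inj₁ k+Q≡P))      = inj₂ (inj₂ k+Q≡P)
SumOrDiff-sym (inj₂ (inj₂ k+P≡Q))      = inj₂ (inj₁ k+P≡Q)

SumOrDiff-≤ : ∀ {k P Q} → SumOrDiff k P Q → k ≤ P + Q
SumOrDiff-≤ (inj₁ refl)                   = ≤-refl
SumOrDiff-≤ {k} {P} {Q} (inj₂ (inj₁ refl)) = ≤-trans (m≤m+n k Q) (m≤m+n (k + Q) Q)
SumOrDiff-≤ {k} {P} {Q} (inj₂ (inj₂ refl)) = ≤-trans (m≤m+n k P) (m≤n+m (k + P) P)

SumOrDiff-≥ : ∀ {k P Q} → SumOrDiff k P Q → P ≤ k + Q
SumOrDiff-≥ {k} {P} {Q} (inj₁ refl)        = ≤-trans (m≤m+n P Q) (m≤m+n (P + Q) Q)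
SumOrDiff-≥ (inj₂ (inj₁ refl))             = ≤-refl
SumOrDiff-≥ {k} {P} {Q} (inj₂ (inj₂ refl)) = ≤-trans (m≤n+m P k) (m≤n+m (k + P) k)

SumOrDiff-∣ : ∀ {d k P Q} → d ∣ P → d ∣ Q → SumOrDiff k P Q → d ∣ k
SumOrDiff-∣ d∣P d∣Q (inj₁ refl) = ∣m∣n⇒∣m+n d∣P d∣Q
SumOrDiff-∣ {d} {k} {P} {Q} d∣P d∣Q (inj₂ (inj₁ refl)) =
  ∣m+n∣m⇒∣n (subst (d ∣_) (+-comm k Q) d∣P) d∣Q
SumOrDiff-∣ {d} {k} {P} {Q} d∣P d∣Q (inj₂ (inj₂ refl)) =
  ∣m+n∣m⇒∣n (subst (d ∣_) (+-comm k P) d∣Q) d∣P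

record Balance (r s P P′ Q Q′ : ℕ) : Set where
  constructor balance
  field
    {W Z}       : ℕ
    r*W≡s*Z     : r * W ≡ s * Z
    W-SumOrDiff : SumOrDiff W P P′
    Z-SumOrDiff : SumOrDiff Z Q Q′

-- The constructor +_ of ℤ is opened only here: globally it makes sections such as (m +_) ambiguous.
module _ where
  open import Data.Integer using (+_; _⊖_)

  ∣⊖∣-SumOrDiff : ∀ P Q → SumOrDiff ℤ.∣ P ⊖ Q ∣ P Q
  ∣⊖∣-SumOrDiff P Q with Q ≤? P
  ... | yes Q≤P rewrite ℤ.⊖-≥ Q≤P = inj₂ (inj₁ (m∸n+n≡m Q≤P))
  ... | no Q≰P  rewrite ℤ.∣⊖∣-≰ Q≰P = inj₂ (inj₂ (m∸n+n≡m (<⇒≤ (≰⇒> Q≰P))))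

  ∣signed-difference∣-SumOrDiff : ∀ e e′ P Q → SumOrDiff ℤ.∣ sgn e ℤ.* + P ℤ.- sgn e′ ℤ.* + Q ∣ P Q
  ∣signed-difference∣-SumOrDiff false false P Q
    rewrite ℤ.*-identityˡ (+ P) | ℤ.*-identityˡ (+ Q) | ℤ.m-n≡m⊖n P Q = ∣⊖∣-SumOrDiff P Q
  ∣signed-difference∣-SumOrDiff false true P Q
    rewrite ℤ.*-identityˡ (+ P) | ℤ.-1*i≡-i (+ Q) | ℤ.neg-involutive (+ Q) | sym (ℤ.pos-+ P Q) = inj₁ refl
  ∣signed-difference∣-SumOrDiff true false P Q
    rewrite ℤ.*-identityˡ (+ Q) | ℤ.-1*i≡-i (+ P) | sym (ℤ.neg-distrib-+ (+ P) (+ Q))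
          | sym (ℤ.pos-+ P Q) | ℤ.∣-i∣≡∣i∣ (+ (P + Q)) = inj₁ refl
  ∣signed-difference∣-SumOrDiff true true P Q
    rewrite ℤ.-1*i≡-i (+ P) | ℤ.-1*i≡-i (+ Q) | ℤ.neg-involutive (+ Q) | ℤ.-m+n≡n⊖m P Q =
    SumOrDiff-sym (∣⊖∣-SumOrDiff Q P)

  sgn-not : ∀ e i → sgn e ℤ.* i ≡ ℤ.- (sgn (not e) ℤ.* i)
  sgn-not false i = trans (ℤ.*-identityˡ i) (sym (trans (cong ℤ.-_ (ℤ.-1*i≡-i i)) (ℤ.neg-involutive i)))
  sgn-not true  i = trans (ℤ.-1*i≡-i i) (cong ℤ.-_ (sym (ℤ.*-identityˡ i)))

  signed-sum-SumOrDiff : ∀ e d P Q c → sgn e ℤ.* + P ℤ.+ sgn d ℤ.* + Q ≡ + c → SumOrDiff c P Q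
  signed-sum-SumOrDiff e d P Q c eq =
    subst (λ k → SumOrDiff k P Q) (cong ℤ.∣_∣ eq′) (∣signed-difference∣-SumOrDiff e (not d) P Q)
    where
    eq′ : sgn e ℤ.* + P ℤ.- sgn (not d) ℤ.* + Q ≡ + c
    eq′ = trans (cong (λ z → sgn e ℤ.* + P ℤ.+ z) (sym (sgn-not d (+ Q)))) eq

  solutions-Balance : ∀ {a b c r s x y x′ y′} →
    IsSolution a b c r s x y → IsSolution a b c r s x′ y′ →
    Balance r s (a ^ x) (a ^ x′) (b ^ y′) (b ^ y)
  solutions-Balance {a} {b} {c} {r} {s} {x} {y} {x′} {y′} (e , d , eq) (e′ , d′ , eq′) =
    balance r*∣E∣≡s*∣F∣ (∣signed-difference∣-SumOrDiff e e′ P P′) (∣signed-difference∣-SumOrDiff d′ d Q′ Q)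
    where
    open ≡-Reasoning
    P = a ^ x ; P′ = a ^ x′ ; Q = b ^ y ; Q′ = b ^ y′
    E = sgn e ℤ.* + P ℤ.- sgn e′ ℤ.* + P′
    F = sgn d′ ℤ.* + Q′ ℤ.- sgn d ℤ.* + Q
    rearrange : ∀ (ε ε′ δ δ′ R S X X′ Y Y′ : ℤ) →
      R ℤ.* (ε ℤ.* X ℤ.- ε′ ℤ.* X′) ℤ.- S ℤ.* (δ′ ℤ.* Y′ ℤ.- δ ℤ.* Y)
        ≡ (ε ℤ.* (R ℤ.* X) ℤ.+ δ ℤ.* (S ℤ.* Y)) ℤ.- (ε′ ℤ.* (R ℤ.* X′) ℤ.+ δ′ ℤ.* (S ℤ.* Y′))
    rearrange = ℤ-Solver.solve-∀
    rE≡sF : + r ℤ.* E ≡ + s ℤ.* F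
    rE≡sF = ℤ.i-j≡0⇒i≡j _ _ (begin
      + r ℤ.* E ℤ.- + s ℤ.* F
        ≡⟨ rearrange (sgn e) (sgn e′) (sgn d) (sgn d′) (+ r) (+ s) (+ P) (+ P′) (+ Q) (+ Q′) ⟩
      (sgn e ℤ.* (+ r ℤ.* + P) ℤ.+ sgn d ℤ.* (+ s ℤ.* + Q))
        ℤ.- (sgn e′ ℤ.* (+ r ℤ.* + P′) ℤ.+ sgn d′ ℤ.* (+ s ℤ.* + Q′))
        ≡⟨ cong₂ ℤ._-_
             (trans (cong₂ (λ m n → sgn e ℤ.* m ℤ.+ sgn d ℤ.* n) (sym (ℤ.pos-* r P)) (sym (ℤ.pos-* s Q))) eq)
             (trans (cong₂ (λ m n → sgn e′ ℤ.* m ℤ.+ sgn d′ ℤ.* n) (sym (ℤ.pos-* r P′)) (sym (ℤ.pos-* s Q′))) eq′) ⟩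
      + c ℤ.- + c
        ≡⟨ ℤ.+-inverseʳ (+ c) ⟩
      + 0 ∎)
    r*∣E∣≡s*∣F∣ : r * ℤ.∣ E ∣ ≡ s * ℤ.∣ F ∣
    r*∣E∣≡s*∣F∣ = begin
      r * ℤ.∣ E ∣      ≡⟨ ℤ.abs-* (+ r) E ⟨
      ℤ.∣ + r ℤ.* E ∣  ≡⟨ cong ℤ.∣_∣ rE≡sF ⟩
      ℤ.∣ + s ℤ.* F ∣  ≡⟨ ℤ.abs-* (+ s) F ⟩
      s * ℤ.∣ F ∣      ∎

  IsSolution-swap : ∀ {a b c r s x y} → IsSolution a b c r s x y → IsSolution b a c s r y x
  IsSolution-swap {a} {b} {c} {r} {s} {x} {y} (u , v , eq) =
    v , u , trans (ℤ.+-comm (sgn v ℤ.* + (s * b ^ y)) (sgn u ℤ.* + (r * a ^ x))) eq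

  IsSolution⇒c≤ : ∀ {a b c r s x y} → IsSolution a b c r s x y → c ≤ r * a ^ x + s * b ^ y
  IsSolution⇒c≤ {a} {b} {c} {r} {s} {x} {y} (e , d , eq) =
    SumOrDiff-≤ (signed-sum-SumOrDiff e d (r * a ^ x) (s * b ^ y) c eq)

1≤n⇒m≤n*m : ∀ {m n} → 1 ≤ n → m ≤ n * m
1≤n⇒m≤n*m {m} {n} 1≤n = m≤n*m m n {{>-nonZero 1≤n}}

1≤n⇒m∣n⇒m≤n : ∀ {m n} → 1 ≤ n → m ∣ n → m ≤ n
1≤n⇒m∣n⇒m≤n 1≤n m∣n = ∣⇒≤ {{>-nonZero 1≤n}} m∣n

m*2≡m+m : ∀ m → m * 2 ≡ m + m
m*2≡m+m m = trans (*-comm m 2) (cong (m +_) (+-identityʳ m))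

m+m≤m*n : ∀ m {n} → 2 ≤ n → m + m ≤ m * n
m+m≤m*n m 2≤n = ≤-trans (≤-reflexive (sym (m*2≡m+m m))) (*-monoʳ-≤ m 2≤n)

m≤m^n : ∀ m {n} .{{_ : NonZero m}} → 1 ≤ n → m ≤ m ^ n
m≤m^n m {suc n} _ = begin
  m          ≡⟨ *-identityʳ m ⟨
  m * 1      ≤⟨ *-monoʳ-≤ m (m^n>0 m n) ⟩
  m * m ^ n  ∎
  where open ≤-Reasoning

2≤m^n : ∀ {m n} → 2 ≤ m → 1 ≤ n → 2 ≤ m ^ n
2≤m^n {m} 2≤m 1≤n = ≤-trans 2≤m (m≤m^n m {{>-nonZero (≤-trans (s≤s z≤n) 2≤m)}} 1≤n)

^-split : ∀ m {n o} → n ≤ o → m ^ o ≡ m ^ n * m ^ (o ∸ n)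
^-split m {n} {o} n≤o = trans (cong (m ^_) (sym (m+[n∸m]≡n n≤o))) (^-distribˡ-+-* m n (o ∸ n))

^-≤-exponent : ∀ {m n o} k → 2 ≤ m → m ^ n ≤ o → o < 2 ^ suc k → n ≤ k
^-≤-exponent {m} {n} k 2≤m mⁿ≤o o<2^k+1 with n ≤? k
... | yes n≤k = n≤k
... | no n≰k  = ⊥-elim (<⇒≱ o<2^k+1
                  (≤-trans (^-monoʳ-≤ 2 (≰⇒> n≰k)) (≤-trans (^-monoˡ-≤ n 2≤m) mⁿ≤o)))

m^n≡2⇒m≡2 : ∀ {m} n → 2 ≤ m → m ^ n ≡ 2 → m ≡ 2
m^n≡2⇒m≡2 zero    _   ()
m^n≡2⇒m≡2 {m} (suc n) 2≤m mⁿ≡2 =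
  ≤-antisym (≤-trans (m≤m^n m {suc n} {{>-nonZero (≤-trans (s≤s z≤n) 2≤m)}} (s≤s z≤n)) (≤-reflexive mⁿ≡2))
            2≤m

2∣2^n : ∀ {n} → 1 ≤ n → 2 ∣ 2 ^ n
2∣2^n {suc n} _ = divides (2 ^ n) (*-comm 2 (2 ^ n))

coprime-*ʳ : ∀ {m n o} → Coprime m (n * o) → Coprime m o
coprime-*ʳ {n = n} m⊥no (i∣m , i∣o) = m⊥no (i∣m , ∣n⇒∣m*n n i∣o)

coprime-*ˡ : ∀ {m n o} → Coprime m (n * o) → Coprime m n
coprime-*ˡ {o = o} m⊥no (i∣m , i∣n) = m⊥no (i∣m , ∣m⇒∣m*n o i∣n)

coprime-^ : ∀ {m n} → Coprime m n → ∀ k → Coprime m (n ^ k)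
coprime-^ m⊥n zero    (_ , i∣1) = ∣1⇒≡1 i∣1
coprime-^ {n = n} m⊥n (suc k) {i} (i∣m , i∣nnᵏ) = coprime-^ m⊥n k (i∣m , coprime-divisor i⊥n i∣nnᵏ)
  where
  i⊥n : Coprime i n
  i⊥n (j∣i , j∣n) = m⊥n (∣-trans j∣i i∣m , j∣n)

-- Bounding the parameters

-- Below u = a^x, A = a^X = u k, v = b^y, B = b^Y for the solutions 1 = (0,Y), 2 = (X,0), 3 = (x,y),
-- and bᵢⱼ is the balance of solutions i and j. The hypotheses k ≡ 2 → 2 ∣ u and B ≡ 2 v → 2 ∣ v
-- record that a power equal to 2 has base 2.
record SmallParameters (u A v B r s : ℕ) : Set where
  constructor small
  field
    u≤5  : u ≤ 5
    A≤10 : A ≤ 10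
    v≤24 : v ≤ 24
    B≤15 : B ≤ 15
    r≤3  : r ≤ 3
    s≤3  : s ≤ 3

coprime-*-≡ : ∀ {r s W Z} .{{_ : NonZero s}} → Coprime s r → r * W ≡ s * Z →
  ∃ λ w → W ≡ w * s × Z ≡ r * w
coprime-*-≡ {r} {s} {W} {Z} s⊥r rW≡sZ with coprime-divisor s⊥r (divides Z (trans rW≡sZ (*-comm s Z)))
... | divides w W≡ws = w , W≡ws , *-cancelˡ-≡ Z (r * w) s (begin
  s * Z        ≡⟨ rW≡sZ ⟨
  r * W        ≡⟨ cong (r *_) W≡ws ⟩
  r * (w * s)  ≡⟨ *-assoc r w s ⟨
  r * w * s    ≡⟨ *-comm (r * w) s ⟩
  s * (r * w)  ∎)
  where open ≡-Reasoning

Balance-∣W : ∀ {r s d P P′ Q Q′} .{{_ : NonZero s}} → Coprime s r → Coprime d r → d ∣ Q → d ∣ Q′ →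
  (b : Balance r s P P′ Q Q′) → s * d ∣ Balance.W b
Balance-∣W {r} {s} {d} s⊥r d⊥r d∣Q d∣Q′ (balance {W} {Z} rW≡sZ _ Z∈QQ′) with coprime-*-≡ s⊥r rW≡sZ
... | w , W≡ws , Z≡rw = subst (s * d ∣_) (trans (*-comm s w) (sym W≡ws)) (*-monoʳ-∣ s d∣w)
  where
  d∣w : d ∣ w
  d∣w = coprime-divisor d⊥r (subst (d ∣_) Z≡rw (SumOrDiff-∣ d∣Q d∣Q′ Z∈QQ′))

Balance-∣Z : ∀ {r s d P P′ Q Q′} → Coprime d s → d ∣ P → d ∣ P′ →
  (b : Balance r s P P′ Q Q′) → d ∣ Balance.Z b
Balance-∣Z {r} {s} {d} d⊥s d∣P d∣P′ (balance rW≡sZ W∈PP′ _) =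
  coprime-divisor d⊥s (subst (d ∣_) rW≡sZ (∣n⇒∣m*n r (SumOrDiff-∣ d∣P d∣P′ W∈PP′)))

unit-balance : ∀ {P P′ Q Q′} (b : Balance 1 1 P P′ Q Q′) → SumOrDiff (Balance.W b) Q Q′
unit-balance (balance {W} {Z} 1*W≡1*Z _ Z∈QQ′) =
  subst (λ z → SumOrDiff z _ _) (sym (trans (sym (*-identityˡ W)) (trans 1*W≡1*Z (*-identityˡ Z)))) Z∈QQ′

2∣m⇒2∤1+m : ∀ {m} → 2 ∣ m → 2 ∣ suc m → ⊥
2∣m⇒2∤1+m 2∣m 2∣1+m with ∣1⇒≡1 (∣m+n∣m⇒∣n (subst (2 ∣_) (+-comm 1 _) 2∣1+m) 2∣m)
... | ()

u≡1+v⊎v≡1+u : ∀ {u v W} → 3 ≤ u → v ≤ suc u → SumOrDiff W (u + u) u → SumOrDiff W v 1 →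
  u ≡ suc v ⊎ v ≡ suc u
u≡1+v⊎v≡1+u {u} {v} {W} 3≤u v≤1+u W∈2uu W∈v1 = adjacent (subst (λ z → SumOrDiff z v 1) (W≡u W∈2uu) W∈v1)
  where
  open ≤-Reasoning
  u≰2 : ¬ u ≤ 2
  u≰2 = <⇒≱ 3≤u
  W≡u : SumOrDiff W (u + u) u → W ≡ u
  W≡u (inj₁ W≡u+u+u) = ⊥-elim (u≰2 (≤-trans (m≤m+n u u) (+-cancelˡ-≤ u (u + u) 2 (begin
    u + (u + u)  ≡⟨ +-assoc u u u ⟨
    u + u + u    ≡⟨ W≡u+u+u ⟨
    W            ≤⟨ SumOrDiff-≤ W∈v1 ⟩
    v + 1        ≤⟨ +-monoˡ-≤ 1 v≤1+u ⟩
    suc u + 1    ≡⟨ +-suc u 1 ⟨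
    u + 2        ∎))))
  W≡u (inj₂ (inj₁ W+u≡u+u))   = +-cancelʳ-≡ u W u W+u≡u+u
  W≡u (inj₂ (inj₂ W+[u+u]≡u)) = ⊥-elim (u≰2 (≤-trans (+-cancelˡ-≤ u u 0 (begin
    u + u        ≤⟨ m≤n+m (u + u) W ⟩
    W + (u + u)  ≡⟨ W+[u+u]≡u ⟩
    u            ≡⟨ +-identityʳ u ⟨
    u + 0        ∎)) z≤n))
  adjacent : SumOrDiff u v 1 → u ≡ suc v ⊎ v ≡ suc u
  adjacent (inj₁ u≡v+1)        = inj₁ (trans u≡v+1 (+-comm v 1))
  adjacent (inj₂ (inj₁ u+1≡v)) = inj₂ (trans (sym u+1≡v) (+-comm u 1))
  adjacent (inj₂ (inj₂ u+v≡1)) = ⊥-elim (u≰2 (≤-trans (≤-trans (m≤m+n u v) (≤-reflexive u+v≡1)) (s≤s z≤n)))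

u≡3×v≡2 : ∀ {u v B W} → 3 ≤ u → 2 ≤ B → 2 ∣ u → (B ≡ 2 * v → 2 ∣ v) → u ≡ suc v ⊎ v ≡ suc u → v ∣ W →
  SumOrDiff W 1 u → SumOrDiff W v B → u ≡ 3 × v ≡ 2
u≡3×v≡2 {u} {v} {B} {W} 3≤u 2≤B 2∣u 2∣v-if adjacent v∣W W∈1u W∈vB = conclude adjacent W∈1u
  where
  open ≤-Reasoning
  u≰2 : ∀ {n} → u ≤ n → n ≤ 2 → ⊥
  u≰2 u≤n n≤2 = <⇒≱ 3≤u (≤-trans u≤n n≤2)
  B≢0 : v + B ≡ v → ⊥
  B≢0 v+B≡v = <⇒≱ 2≤B (≤-trans (+-cancelˡ-≤ v B 0 (≤-reflexive (trans v+B≡v (sym (+-identityʳ v))))) z≤n)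
  v≢v+v : SumOrDiff v v B → ⊥
  v≢v+v (inj₁ v≡v+B)        = B≢0 (sym v≡v+B)
  v≢v+v (inj₂ (inj₁ v+B≡v)) = B≢0 v+B≡v
  v≢v+v (inj₂ (inj₂ v+v≡B)) = not-both-even adjacent (2∣v-if (trans (sym v+v≡B) (cong (v +_) (sym (+-identityʳ v)))))
    where
    not-both-even : u ≡ suc v ⊎ v ≡ suc u → 2 ∣ v → ⊥
    not-both-even (inj₁ u≡1+v) 2∣v = 2∣m⇒2∤1+m 2∣v (subst (2 ∣_) u≡1+v 2∣u)
    not-both-even (inj₂ v≡1+u) 2∣v = 2∣m⇒2∤1+m 2∣u (subst (2 ∣_) v≡1+u 2∣v)
  W≢v : W ≢ v
  W≢v W≡v = v≢v+v (subst (λ z → SumOrDiff z v B) W≡v W∈vB)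
  conclude : u ≡ suc v ⊎ v ≡ suc u → SumOrDiff W 1 u → u ≡ 3 × v ≡ 2
  conclude _ (inj₂ (inj₁ W+u≡1)) = ⊥-elim (u≰2 (≤-trans (m≤n+m u W) (≤-reflexive W+u≡1)) (s≤s z≤n))
  conclude (inj₁ u≡1+v) (inj₁ W≡1+u) = trans u≡1+v (cong suc v≡2) , v≡2
    where
    v∣2 : v ∣ 2
    v∣2 = ∣m+n∣m⇒∣n (subst (v ∣_) (trans W≡1+u (trans (cong suc u≡1+v) (+-comm 2 v))) v∣W) ∣-refl
    v≡2 : v ≡ 2
    v≡2 = ≤-antisym (1≤n⇒m∣n⇒m≤n (s≤s z≤n) v∣2) (s≤s⁻¹ (≤-trans 3≤u (≤-reflexive u≡1+v)))
  conclude (inj₁ u≡1+v) (inj₂ (inj₂ W+1≡u)) =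
    ⊥-elim (W≢v (suc-injective (trans (+-comm 1 W) (trans W+1≡u u≡1+v))))
  conclude (inj₂ v≡1+u) (inj₁ W≡1+u) = ⊥-elim (W≢v (trans W≡1+u (sym v≡1+u)))
  conclude (inj₂ v≡1+u) (inj₂ (inj₂ W+1≡u)) = ⊥-elim (<⇒≱ (begin-strict
    W      <⟨ m<m+n W (s≤s z≤n) ⟩
    W + 1  ≡⟨ W+1≡u ⟩
    u      <⟨ n<1+n u ⟩
    suc u  ≡⟨ v≡1+u ⟨
    v      ∎) (1≤n⇒m∣n⇒m≤n 1≤W v∣W))
    where
    1≤W : 1 ≤ W
    1≤W = s≤s⁻¹ (≤-trans (≤-trans (s≤s (s≤s z≤n)) 3≤u) (≤-reflexive (trans (sym W+1≡u) (+-comm W 1))))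

small-when-sB≤1+u : ∀ {u A k v B r s} → 2 ≤ u → A ≡ u * k → 2 ≤ k → 2 ≤ B → 1 ≤ r → 1 ≤ s →
  s * B ≤ suc u → v ≤ r * suc u + B → Balance r s 1 A 1 B → SmallParameters u A v B r s
small-when-sB≤1+u {u} {A} {k} {v} {B} {r} {s} 2≤u A≡uk 2≤k 2≤B 1≤r 1≤s sB≤1+u v≤
  (balance {W} {Z} rW≡sZ W∈1A Z∈1B) =
  small u≤5 A≤10 v≤24 (≤-trans B≤6 (m≤m+n 6 9)) r≤3 s≤3
  where
  open ≤-Reasoning
  A≤W+1 : A ≤ W + 1
  A≤W+1 = SumOrDiff-≥ (SumOrDiff-sym W∈1A)
  2u≤W+1 : u + u ≤ W + 1
  2u≤W+1 = ≤-trans (m+m≤m*n u 2≤k) (≤-trans (≤-reflexive (sym A≡uk)) A≤W+1)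
  rW≤s+1+u : r * W ≤ s + suc u
  rW≤s+1+u = begin
    r * W      ≡⟨ rW≡sZ ⟩
    s * Z      ≤⟨ *-monoʳ-≤ s (SumOrDiff-≤ Z∈1B) ⟩
    s * suc B  ≡⟨ *-suc s B ⟩
    s + s * B  ≤⟨ +-monoʳ-≤ s sB≤1+u ⟩
    s + suc u  ∎
  u≤s+2 : u ≤ s + 2
  u≤s+2 = +-cancelˡ-≤ u u (s + 2) (begin
    u + u          ≤⟨ 2u≤W+1 ⟩
    W + 1          ≤⟨ +-monoˡ-≤ 1 (≤-trans (1≤n⇒m≤n*m 1≤r) rW≤s+1+u) ⟩
    s + suc u + 1  ≡⟨ rearrange s u ⟩
    u + (s + 2)    ∎)
    where
    rearrange : ∀ s u → s + suc u + 1 ≡ u + (s + 2)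
    rearrange = solve-∀
  s≤3 : s ≤ 3
  s≤3 = +-cancelˡ-≤ s s 3 (begin
    s + s        ≤⟨ m+m≤m*n s 2≤B ⟩
    s * B        ≤⟨ sB≤1+u ⟩
    suc u        ≤⟨ s≤s u≤s+2 ⟩
    suc (s + 2)  ≡⟨ +-suc s 2 ⟨
    s + 3        ∎)
  u≤5 : u ≤ 5
  u≤5 = ≤-trans u≤s+2 (+-monoˡ-≤ 2 s≤3)
  B≤6 : B ≤ 6
  B≤6 = ≤-trans (1≤n⇒m≤n*m 1≤s) (≤-trans sB≤1+u (s≤s u≤5))
  rW≤9 : r * W ≤ 9
  rW≤9 = ≤-trans rW≤s+1+u (+-mono-≤ s≤3 (s≤s u≤5))
  r≤3 : r ≤ 3
  r≤3 = *-cancelʳ-≤ r 3 3 (≤-trans (*-monoʳ-≤ r 3≤W) rW≤9)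
    where
    3≤W : 3 ≤ W
    3≤W = +-cancelʳ-≤ 1 3 W (≤-trans (+-mono-≤ 2≤u 2≤u) 2u≤W+1)
  A≤10 : A ≤ 10
  A≤10 = ≤-trans A≤W+1 (+-monoˡ-≤ 1 (≤-trans (1≤n⇒m≤n*m 1≤r) rW≤9))
  v≤24 : v ≤ 24
  v≤24 = ≤-trans v≤ (+-mono-≤ (*-mono-≤ r≤3 (s≤s u≤5)) B≤6)

small-when-sv≤1+u : ∀ {u A k v B r s} → A ≡ u * k → 2 ≤ k → 2 ≤ v → 1 ≤ r → 2 ≤ s →
  s * v ≤ suc u → u ≤ v + 1 → Balance r s 1 A 1 B → Balance r s A u v 1 → SmallParameters u A v B r s
small-when-sv≤1+u {u} {A} {k} {v} {B} {r} {s} A≡uk 2≤k 2≤v 1≤r 2≤s sv≤1+u u≤v+1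
  (balance {W₁₂} {Z₁₂} rW₁₂≡sZ₁₂ W₁₂∈1A Z₁₂∈1B)
  (balance {W₂₃} {Z₂₃} rW₂₃≡sZ₂₃ W₂₃∈Au Z₂₃∈v1) =
  small (≤-trans u≤3 (m≤m+n 3 2)) (≤-trans A≤9 (n≤1+n 9)) (≤-trans v≤2 (m≤m+n 2 22))
        (≤-trans B≤11 (m≤m+n 11 4)) (≤-trans r≤2 (n≤1+n 2)) (≤-trans s≤2 (n≤1+n 2))
  where
  open ≤-Reasoning
  v≤2 : v ≤ 2
  v≤2 = +-cancelˡ-≤ v v 2 (begin
    v + v        ≡⟨ cong (v +_) (+-identityʳ v) ⟨
    2 * v        ≤⟨ *-monoˡ-≤ v 2≤s ⟩
    s * v        ≤⟨ sv≤1+u ⟩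
    suc u        ≤⟨ s≤s u≤v+1 ⟩
    suc (v + 1)  ≡⟨ +-suc v 1 ⟨
    v + 2        ∎)
  u≤3 : u ≤ 3
  u≤3 = ≤-trans u≤v+1 (+-monoˡ-≤ 1 v≤2)
  3≤u : 3 ≤ u
  3≤u = s≤s⁻¹ (≤-trans (*-mono-≤ 2≤s 2≤v) sv≤1+u)
  s≤2 : s ≤ 2
  s≤2 = *-cancelʳ-≤ s 2 2 (≤-trans (*-monoʳ-≤ s 2≤v) (≤-trans sv≤1+u (s≤s u≤3)))
  rW₂₃≤6 : r * W₂₃ ≤ 6
  rW₂₃≤6 = begin
    r * W₂₃  ≡⟨ rW₂₃≡sZ₂₃ ⟩
    s * Z₂₃  ≤⟨ *-mono-≤ s≤2 (≤-trans (SumOrDiff-≤ Z₂₃∈v1) (+-monoˡ-≤ 1 v≤2)) ⟩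
    6        ∎
  A≤W₂₃+u : A ≤ W₂₃ + u
  A≤W₂₃+u = SumOrDiff-≥ W₂₃∈Au
  r≤2 : r ≤ 2
  r≤2 = *-cancelʳ-≤ r 2 3 (≤-trans (*-monoʳ-≤ r (≤-trans 3≤u u≤W₂₃)) rW₂₃≤6)
    where
    u≤W₂₃ : u ≤ W₂₃
    u≤W₂₃ = +-cancelʳ-≤ u u W₂₃ (≤-trans (m+m≤m*n u 2≤k) (≤-trans (≤-reflexive (sym A≡uk)) A≤W₂₃+u))
  A≤9 : A ≤ 9
  A≤9 = ≤-trans A≤W₂₃+u (+-mono-≤ (≤-trans (1≤n⇒m≤n*m 1≤r) rW₂₃≤6) u≤3)
  B≤11 : B ≤ 11
  B≤11 = ≤-trans (SumOrDiff-≥ (SumOrDiff-sym Z₁₂∈1B)) (+-monoˡ-≤ 1 Z₁₂≤10)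
    where
    Z₁₂≤10 : Z₁₂ ≤ 10
    Z₁₂≤10 = *-cancelˡ-≤ 2 (begin
      2 * Z₁₂  ≤⟨ *-monoˡ-≤ Z₁₂ 2≤s ⟩
      s * Z₁₂  ≡⟨ rW₁₂≡sZ₁₂ ⟨
      r * W₁₂  ≤⟨ *-mono-≤ r≤2 (≤-trans (SumOrDiff-≤ W₁₂∈1A) (s≤s A≤9)) ⟩
      2 * 10   ∎)

small-when-r≡s≡1 : ∀ {u A v B r s} → r ≡ 1 → s ≡ 1 → A ≡ u + u → 3 ≤ u → 2 ≤ B → 2 ∣ u →
  (B ≡ 2 * v → 2 ∣ v) → v ≤ suc u → (b₁₃ : Balance r s 1 u v B) → v ∣ Balance.W b₁₃ →
  Balance r s 1 A 1 B → Balance r s A u v 1 → SmallParameters u A v B r s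
small-when-r≡s≡1 {B = B} refl refl refl 3≤u 2≤B 2∣u 2∣v-if v≤1+u b₁₃ v∣W₁₃ b₁₂ b₂₃
  with u≡3×v≡2 3≤u 2≤B 2∣u 2∣v-if
         (u≡1+v⊎v≡1+u 3≤u v≤1+u (Balance.W-SumOrDiff b₂₃) (unit-balance b₂₃))
         v∣W₁₃ (Balance.W-SumOrDiff b₁₃) (unit-balance b₁₃)
... | refl , refl = small (m≤m+n 3 2) (m≤m+n 6 4) (m≤m+n 2 22) (≤-trans B≤8 (m≤m+n 8 7)) (m≤m+n 1 2) (m≤m+n 1 2)
  where
  B≤8 : B ≤ 8
  B≤8 = ≤-trans (SumOrDiff-≥ (SumOrDiff-sym (unit-balance b₁₂)))
                (+-monoˡ-≤ 1 (SumOrDiff-≤ (Balance.W-SumOrDiff b₁₂)))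

small-when-u≤2 : ∀ {u A k v B r} → u ≤ 2 → 2 ≤ u → A ≡ u * k → 2 ≤ k → 1 ≤ r → v ≤ suc u →
  Balance r 1 1 A 1 B → Balance r 1 A u v 1 → SmallParameters u A v B r 1
small-when-u≤2 {u} {A} {k} {v} {B} {r} u≤2 2≤u A≡uk 2≤k 1≤r v≤1+u b₁₂ b₂₃ =
  small (≤-trans u≤2 (m≤m+n 2 3)) (≤-trans A≤6 (m≤m+n 6 4)) (≤-trans v≤1+u (s≤s (≤-trans u≤2 (m≤m+n 2 21))))
        B≤15 (≤-trans r≤2 (n≤1+n 2)) (m≤m+n 1 2)
  where
  open ≤-Reasoning
  module B₁₂ = Balance b₁₂
  module B₂₃ = Balance b₂₃
  rW₂₃≤4 : r * B₂₃.W ≤ 4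
  rW₂₃≤4 = begin
    r * B₂₃.W  ≡⟨ B₂₃.r*W≡s*Z ⟩
    1 * B₂₃.Z  ≡⟨ *-identityˡ B₂₃.Z ⟩
    B₂₃.Z      ≤⟨ SumOrDiff-≤ B₂₃.Z-SumOrDiff ⟩
    v + 1      ≤⟨ +-monoˡ-≤ 1 (≤-trans v≤1+u (s≤s u≤2)) ⟩
    4          ∎
  A≤W₂₃+2 : A ≤ B₂₃.W + 2
  A≤W₂₃+2 = ≤-trans (SumOrDiff-≥ B₂₃.W-SumOrDiff) (+-monoʳ-≤ B₂₃.W u≤2)
  r≤2 : r ≤ 2
  r≤2 = *-cancelʳ-≤ r 2 2 (≤-trans (*-monoʳ-≤ r 2≤W₂₃) rW₂₃≤4)
    where
    2≤W₂₃ : 2 ≤ B₂₃.W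
    2≤W₂₃ = +-cancelʳ-≤ 2 2 B₂₃.W (≤-trans (+-mono-≤ 2≤u 2≤u)
              (≤-trans (m+m≤m*n u 2≤k) (≤-trans (≤-reflexive (sym A≡uk)) A≤W₂₃+2)))
  A≤6 : A ≤ 6
  A≤6 = ≤-trans A≤W₂₃+2 (+-monoˡ-≤ 2 (≤-trans (1≤n⇒m≤n*m 1≤r) rW₂₃≤4))
  B≤15 : B ≤ 15
  B≤15 = begin
    B              ≤⟨ SumOrDiff-≥ (SumOrDiff-sym B₁₂.Z-SumOrDiff) ⟩
    B₁₂.Z + 1      ≡⟨ cong (_+ 1) (trans B₁₂.r*W≡s*Z (*-identityˡ B₁₂.Z)) ⟨
    r * B₁₂.W + 1  ≤⟨ +-monoˡ-≤ 1 (*-mono-≤ r≤2 (≤-trans (SumOrDiff-≤ B₁₂.W-SumOrDiff) (s≤s A≤6))) ⟩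
    15             ∎

k≡2×r≡1 : ∀ {u A k v r} → 3 ≤ u → A ≡ u * k → 2 ≤ k → 1 ≤ r → v ≤ suc u → Balance r 1 A u v 1 →
  k ≡ 2 × r ≡ 1
k≡2×r≡1 {u} {A} {k} {v} {r} 3≤u A≡uk 2≤k 1≤r v≤1+u (balance {W} {Z} rW≡Z W∈Au Z∈v1) = k≡2 , r≡1
  where
  open ≤-Reasoning
  u≰2 : ¬ u ≤ 2
  u≰2 = <⇒≱ 3≤u
  rW≤u+2 : r * W ≤ u + 2
  rW≤u+2 = begin
    r * W      ≡⟨ rW≡Z ⟩
    1 * Z      ≡⟨ *-identityˡ Z ⟩
    Z          ≤⟨ SumOrDiff-≤ Z∈v1 ⟩
    v + 1      ≤⟨ +-monoˡ-≤ 1 v≤1+u ⟩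
    suc u + 1  ≡⟨ +-suc u 1 ⟨
    u + 2      ∎
  A≤W+u : A ≤ W + u
  A≤W+u = SumOrDiff-≥ W∈Au
  k≡2 : k ≡ 2
  k≡2 with k ≤? 2
  ... | yes k≤2 = ≤-antisym k≤2 2≤k
  ... | no k≰2 = ⊥-elim (u≰2 (+-cancelˡ-≤ u u 2 (+-cancelˡ-≤ u (u + u) (u + 2) (begin
    u + (u + u)  ≡⟨ cong (λ z → u + (u + z)) (+-identityʳ u) ⟨
    3 * u        ≡⟨ *-comm 3 u ⟩
    u * 3        ≤⟨ *-monoʳ-≤ u (≰⇒> k≰2) ⟩
    u * k        ≡⟨ A≡uk ⟨
    A            ≤⟨ A≤W+u ⟩
    W + u        ≤⟨ +-monoˡ-≤ u (≤-trans (1≤n⇒m≤n*m 1≤r) rW≤u+2) ⟩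
    u + 2 + u    ≡⟨ +-comm (u + 2) u ⟩
    u + (u + 2)  ∎))))
  r≡1 : r ≡ 1
  r≡1 with r ≤? 1
  ... | yes r≤1 = ≤-antisym r≤1 1≤r
  ... | no r≰1 = ⊥-elim (u≰2 (+-cancelˡ-≤ u u 2 (begin
    u + u        ≤⟨ +-mono-≤ u≤W u≤W ⟩
    W + W        ≤⟨ m+m≤m*n W (≰⇒> r≰1) ⟩
    W * r        ≡⟨ *-comm W r ⟩
    r * W        ≤⟨ rW≤u+2 ⟩
    u + 2        ∎)))
    where
    u≤W : u ≤ W
    u≤W = +-cancelʳ-≤ u u W (≤-trans (m+m≤m*n u 2≤k) (≤-trans (≤-reflexive (sym A≡uk)) A≤W+u))

small-when-s≡1 : ∀ {u A k v B r s} → s ≡ 1 → 2 ≤ u → A ≡ u * k → 2 ≤ k → 2 ≤ B → 1 ≤ r →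
  (k ≡ 2 → 2 ∣ u) → (B ≡ 2 * v → 2 ∣ v) → v ≤ suc u →
  (b₁₃ : Balance r s 1 u v B) → v ∣ Balance.W b₁₃ →
  Balance r s 1 A 1 B → Balance r s A u v 1 → SmallParameters u A v B r s
small-when-s≡1 {u} refl 2≤u A≡uk 2≤k 2≤B 1≤r 2∣u-if 2∣v-if v≤1+u b₁₃ v∣W₁₃ b₁₂ b₂₃ with u ≤? 2
... | yes u≤2 = small-when-u≤2 u≤2 2≤u A≡uk 2≤k 1≤r v≤1+u b₁₂ b₂₃
... | no u≰2 with k≡2×r≡1 (≰⇒> u≰2) A≡uk 2≤k 1≤r v≤1+u b₂₃
...   | k≡2 , r≡1 = small-when-r≡s≡1 r≡1 refl (trans A≡uk (trans (cong (u *_) k≡2) (m*2≡m+m u)))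
                       (≰⇒> u≰2) 2≤B (2∣u-if k≡2) 2∣v-if v≤1+u b₁₃ v∣W₁₃ b₁₂ b₂₃

small-parameters : ∀ {u A k v B r s} → 2 ≤ u → A ≡ u * k → 2 ≤ k → 2 ≤ v → 2 ≤ B → 1 ≤ r → 1 ≤ s →
  Coprime s r → Coprime u s → (k ≡ 2 → 2 ∣ u) →
  (v ∣ B × Coprime v r × (B ≡ 2 * v → 2 ∣ v)) ⊎ (B ∣ v × Coprime B r) →
  Balance r s 1 u v B → Balance r s 1 A 1 B → Balance r s A u v 1 → SmallParameters u A v B r s
small-parameters {u} {A} {k} {v} {B} {r} {s} 2≤u A≡uk 2≤k 2≤v 2≤B 1≤r 1≤s s⊥r u⊥s 2∣u-if v∣B⊎B∣v
  b₁₃ b₁₂ b₂₃ =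
  by-cases v∣B⊎B∣v
  where
  open ≤-Reasoning
  module B₁₃ = Balance b₁₃
  module B₂₃ = Balance b₂₃
  s*d≤1+u : ∀ {d} → Coprime d r → d ∣ v → d ∣ B → s * d ≤ suc u
  s*d≤1+u d⊥r d∣v d∣B = ≤-trans (1≤n⇒m∣n⇒m≤n 1≤W₁₃ (Balance-∣W {{>-nonZero 1≤s}} s⊥r d⊥r d∣v d∣B b₁₃))
                                 (SumOrDiff-≤ B₁₃.W-SumOrDiff)
    where
    1≤W₁₃ : 1 ≤ B₁₃.W
    1≤W₁₃ = +-cancelʳ-≤ 1 1 B₁₃.W (≤-trans 2≤u (SumOrDiff-≥ (SumOrDiff-sym B₁₃.W-SumOrDiff)))
  u≤v+1 : u ≤ v + 1
  u≤v+1 = ≤-trans (1≤n⇒m∣n⇒m≤n 1≤Z₂₃ (Balance-∣Z u⊥s (divides k (trans A≡uk (*-comm u k))) ∣-refl b₂₃))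
                  (SumOrDiff-≤ B₂₃.Z-SumOrDiff)
    where
    1≤Z₂₃ : 1 ≤ B₂₃.Z
    1≤Z₂₃ = +-cancelʳ-≤ 1 1 B₂₃.Z (≤-trans 2≤v (SumOrDiff-≥ B₂₃.Z-SumOrDiff))
  v≤r[1+u]+B : v ≤ r * suc u + B
  v≤r[1+u]+B = ≤-trans (SumOrDiff-≥ B₁₃.Z-SumOrDiff) (+-monoˡ-≤ B (begin
    B₁₃.Z      ≤⟨ 1≤n⇒m≤n*m 1≤s ⟩
    s * B₁₃.Z  ≡⟨ B₁₃.r*W≡s*Z ⟨
    r * B₁₃.W  ≤⟨ *-monoʳ-≤ r (SumOrDiff-≤ B₁₃.W-SumOrDiff) ⟩
    r * suc u  ∎))
  by-cases : (v ∣ B × Coprime v r × (B ≡ 2 * v → 2 ∣ v)) ⊎ (B ∣ v × Coprime B r) → SmallParameters u A v B r s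
  by-cases (inj₂ (B∣v , B⊥r)) =
    small-when-sB≤1+u 2≤u A≡uk 2≤k 2≤B 1≤r 1≤s (s*d≤1+u B⊥r B∣v ∣-refl) v≤r[1+u]+B b₁₂
  by-cases (inj₁ (v∣B , v⊥r , 2∣v-if)) with s ≤? 1
  ... | no s≰1 = small-when-sv≤1+u A≡uk 2≤k 2≤v 1≤r (≰⇒> s≰1) (s*d≤1+u v⊥r ∣-refl v∣B) u≤v+1 b₁₂ b₂₃
  ... | yes s≤1 = small-when-s≡1 s≡1 2≤u A≡uk 2≤k 2≤B 1≤r 2∣u-if 2∣v-if
                    (≤-trans (≤-reflexive (sym (*-identityˡ v)))
                             (subst (λ z → z * v ≤ suc u) s≡1 (s*d≤1+u v⊥r ∣-refl v∣B))) b₁₃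
                    (m*n∣⇒n∣ s v (Balance-∣W {{>-nonZero 1≤s}} s⊥r v⊥r ∣-refl v∣B b₁₃)) b₁₂ b₂₃
    where
    s≡1 : s ≡ 1
    s≡1 = ≤-antisym s≤1 1≤s

-- 7 as a sum or difference of a power of 3 and a power of 2

even-or-odd : ∀ m → ∃ λ j → m ≡ 2 * j ⊎ m ≡ suc (2 * j)
even-or-odd zero = 0 , inj₁ refl
even-or-odd (suc m) with even-or-odd m
... | j , inj₁ m≡2j  = j , inj₂ (cong suc m≡2j)
... | j , inj₂ m≡1+2j = suc j , inj₁ (trans (cong suc m≡1+2j) (sym (+-suc (suc j) (j + 0))))

+-%-cong : ∀ a X Y n .{{_ : NonZero n}} → X % n ≡ Y % n → (a + X) % n ≡ (a + Y) % n
+-%-cong a X Y n X≡Y = begin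
  (a + X) % n            ≡⟨ %-distribˡ-+ a X n ⟩
  (a % n + X % n) % n    ≡⟨ cong (λ z → (a % n + z) % n) X≡Y ⟩
  (a % n + Y % n) % n    ≡⟨ %-distribˡ-+ a Y n ⟨
  (a + Y) % n            ∎
  where open ≡-Reasoning

*-%-cong : ∀ a X Y n .{{_ : NonZero n}} → X % n ≡ Y % n → (a * X) % n ≡ (a * Y) % n
*-%-cong a X Y n X≡Y = begin
  (a * X) % n            ≡⟨ %-distribˡ-* a X n ⟩
  (a % n * (X % n)) % n  ≡⟨ cong (λ z → (a % n * z) % n) X≡Y ⟩
  (a % n * (Y % n)) % n  ≡⟨ %-distribˡ-* a Y n ⟨
  (a * Y) % n            ∎
  where open ≡-Reasoning

^-%-≡1 : ∀ m j n .{{_ : NonZero n}} → m % n ≡ 1 % n → m ^ j % n ≡ 1 % n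
^-%-≡1 m zero    n _      = refl
^-%-≡1 m (suc j) n m≡1 = begin
  m * m ^ j % n  ≡⟨ *-%-cong m (m ^ j) 1 n (^-%-≡1 m j n m≡1) ⟩
  m * 1 % n      ≡⟨ cong (_% n) (*-identityʳ m) ⟩
  m % n          ≡⟨ m≡1 ⟩
  1 % n          ∎
  where open ≡-Reasoning

3^[2j]%8≡1 : ∀ j → 3 ^ (2 * j) % 8 ≡ 1
3^[2j]%8≡1 j = trans (cong (_% 8) (sym (^-*-assoc 3 2 j))) (^-%-≡1 9 j 8 refl)

3^[1+2j]%8≡3 : ∀ j → 3 ^ suc (2 * j) % 8 ≡ 3
3^[1+2j]%8≡3 j = *-%-cong 3 (3 ^ (2 * j)) 1 8 (3^[2j]%8≡1 j)

3^m%8 : ∀ m → 3 ^ m % 8 ≡ 1 ⊎ 3 ^ m % 8 ≡ 3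
3^m%8 m with even-or-odd m
... | j , inj₁ refl = inj₁ (3^[2j]%8≡1 j)
... | j , inj₂ refl = inj₂ (3^[1+2j]%8≡3 j)

2*2^n%8≡0 : ∀ {n} → 3 ≤ n → 2 * 2 ^ n % 8 ≡ 0
2*2^n%8≡0 {1} (s≤s ())
2*2^n%8≡0 {2} (s≤s (s≤s ()))
2*2^n%8≡0 {suc (suc (suc n))} _ = trans (cong (_% 8) (rearrange (2 ^ n))) (m*n%n≡0 (2 * 2 ^ n) 8)
  where
  rearrange : ∀ z → 2 * (2 * (2 * (2 * z))) ≡ 2 * z * 8
  rearrange = solve-∀

7+P²≡Q²⇒P≤3 : ∀ P Q → 7 + P * P ≡ Q * Q → P ≤ 3
7+P²≡Q²⇒P≤3 P Q 7+P²≡Q² with Q ≤? P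
... | yes Q≤P = ⊥-elim (<⇒≱ (≤-trans (s≤s (m≤n+m (P * P) 6)) (≤-reflexive 7+P²≡Q²)) (*-mono-≤ Q≤P Q≤P))
... | no Q≰P with P ≤? 3
...   | yes P≤3 = P≤3
...   | no P≰3 = ⊥-elim (<⇒≱ (begin-strict
  7                      <⟨ +-mono-≤ (≰⇒> P≰3) (≰⇒> P≰3) ⟩
  P + P                  ≤⟨ +-mono-≤ P≤Pd P≤Pd ⟩
  P * d + P * d          ≤⟨ m≤m+n (P * d + P * d) (d * d) ⟩
  P * d + P * d + d * d
    ≡⟨ +-cancelʳ-≡ (P * P) 7 _ (trans 7+P²≡Q² (trans (cong (λ z → z * z) Q≡P+d) (square P d))) ⟨
  7                      ∎) ≤-refl)
  where
  open ≤-Reasoning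
  d = Q ∸ P
  Q≡P+d : Q ≡ P + d
  Q≡P+d = sym (m+[n∸m]≡n (<⇒≤ (≰⇒> Q≰P)))
  P≤Pd : P ≤ P * d
  P≤Pd = m≤m*n P d {{>-nonZero (m<n⇒0<n∸m (≰⇒> Q≰P))}}
  square : ∀ P d → (P + d) * (P + d) ≡ P * d + P * d + d * d + P * P
  square = solve-∀

m^[2j]≡m^j*m^j : ∀ m j → m ^ (2 * j) ≡ m ^ j * m ^ j
m^[2j]≡m^j*m^j m j = trans (^-distribˡ-+-* m j (j + 0)) (cong (λ z → m ^ j * m ^ z) (+-identityʳ j))

7+3^[2j]≡2^[1+2i]⇒j≡0 : ∀ j i → 7 + 3 ^ (2 * j) ≡ 2 * 2 ^ (2 * i) → j ≡ 0
7+3^[2j]≡2^[1+2i]⇒j≡0 zero    i _ = refl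
7+3^[2j]≡2^[1+2i]⇒j≡0 (suc j) i eq = contradiction (begin
  1                          ≡⟨ +-%-cong 7 (3 ^ (2 * suc j)) 0 3 3^[2+2j]%3≡0 ⟨
  (7 + 3 ^ (2 * suc j)) % 3  ≡⟨ cong (_% 3) eq ⟩
  2 * 2 ^ (2 * i) % 3        ≡⟨ *-%-cong 2 (2 ^ (2 * i)) 1 3 2^[2i]%3≡1 ⟩
  2                          ∎) λ ()
  where
  open ≡-Reasoning
  3^[2+2j]%3≡0 : 3 ^ (2 * suc j) % 3 ≡ 0
  3^[2+2j]%3≡0 = trans (cong (_% 3) (*-comm 3 (3 ^ (j + suc (j + 0))))) (m*n%n≡0 (3 ^ (j + suc (j + 0))) 3)
  2^[2i]%3≡1 : 2 ^ (2 * i) % 3 ≡ 1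
  2^[2i]%3≡1 = trans (cong (_% 3) (sym (^-*-assoc 2 2 i))) (^-%-≡1 4 i 3 refl)

7+3^[2j]≡2^[2+2i]⇒j≤1 : ∀ j i → 7 + 3 ^ (2 * j) ≡ 2 * 2 ^ suc (2 * i) → j ≤ 1
7+3^[2j]≡2^[2+2i]⇒j≤1 j i eq = ^-≤-exponent 1 (s≤s (s≤s z≤n)) (7+P²≡Q²⇒P≤3 (3 ^ j) (2 * 2 ^ i) (begin
  7 + 3 ^ j * 3 ^ j              ≡⟨ cong (7 +_) (m^[2j]≡m^j*m^j 3 j) ⟨
  7 + 3 ^ (2 * j)                ≡⟨ eq ⟩
  2 * (2 * 2 ^ (2 * i))          ≡⟨ cong (λ z → 2 * (2 * z)) (m^[2j]≡m^j*m^j 2 i) ⟩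
  2 * (2 * (2 ^ i * 2 ^ i))      ≡⟨ rearrange (2 ^ i) ⟩
  2 * 2 ^ i * (2 * 2 ^ i)        ∎)) (s≤s (s≤s (s≤s (s≤s z≤n))))
  where
  open ≡-Reasoning
  rearrange : ∀ z → 2 * (2 * (z * z)) ≡ 2 * z * (2 * z)
  rearrange = solve-∀

7≢3^m±2^[1+n] : ∀ m n → 3 ≤ m → 3 ≤ n → ¬ SumOrDiff 7 (3 ^ m) (2 * 2 ^ n)
7≢3^m±2^[1+n] m n 3≤m 3≤n (inj₁ 7≡3^m+2^[1+n]) =
  <⇒≱ (≤-trans (m≤m+n 8 19) (^-monoʳ-≤ 3 3≤m)) (≤-trans (m≤m+n (3 ^ m) _) (≤-reflexive (sym 7≡3^m+2^[1+n])))
7≢3^m±2^[1+n] m n 3≤m 3≤n (inj₂ (inj₁ 7+2^[1+n]≡3^m)) = ≢7 (3^m%8 m)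
  where
  3ᵐ%8≡7 : 3 ^ m % 8 ≡ 7
  3ᵐ%8≡7 = trans (cong (_% 8) (sym 7+2^[1+n]≡3^m)) (+-%-cong 7 (2 * 2 ^ n) 0 8 (2*2^n%8≡0 3≤n))
  ≢7 : 3 ^ m % 8 ≡ 1 ⊎ 3 ^ m % 8 ≡ 3 → ⊥
  ≢7 (inj₁ 3ᵐ%8≡1) = contradiction (trans (sym 3ᵐ%8≡1) 3ᵐ%8≡7) λ ()
  ≢7 (inj₂ 3ᵐ%8≡3) = contradiction (trans (sym 3ᵐ%8≡3) 3ᵐ%8≡7) λ ()
7≢3^m±2^[1+n] m n 3≤m 3≤n (inj₂ (inj₂ 7+3^m≡2^[1+n])) with even-or-odd m | even-or-odd n
... | j , inj₂ refl | _ = contradiction (begin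
  2                            ≡⟨ +-%-cong 7 (3 ^ suc (2 * j)) 3 8 (3^[1+2j]%8≡3 j) ⟨
  (7 + 3 ^ suc (2 * j)) % 8    ≡⟨ cong (_% 8) 7+3^m≡2^[1+n] ⟩
  2 * 2 ^ n % 8                ≡⟨ 2*2^n%8≡0 3≤n ⟩
  0                            ∎) λ ()
  where open ≡-Reasoning
... | j , inj₁ refl | i , inj₁ refl =
  <⇒≱ 3≤m (*-monoʳ-≤ 2 (≤-trans (≤-reflexive (7+3^[2j]≡2^[1+2i]⇒j≡0 j i 7+3^m≡2^[1+n])) (z≤n {1})))
... | j , inj₁ refl | i , inj₂ refl =
  <⇒≱ 3≤m (*-monoʳ-≤ 2 (7+3^[2j]≡2^[2+2i]⇒j≤1 j i 7+3^m≡2^[1+n]))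

-- The finite search

∃-Bool? : {P : Bool → Set} → (∀ b → Dec (P b)) → Dec (Σ Bool P)
∃-Bool? P? with P? true | P? false
... | yes p | _     = yes (true , p)
... | _     | yes p = yes (false , p)
... | no ¬t | no ¬f = no λ { (true , p) → ¬t p ; (false , p) → ¬f p }

isSolution? : ∀ a b c r s x y → Dec (IsSolution a b c r s x y)
isSolution? a b c r s x y = ∃-Bool? λ _ → ∃-Bool? λ _ → _ ℤ.≟ _

ExceptionalParameters : (a b r s : ℕ) → Set
ExceptionalParameters a b r s = (a ≡ 3 × b ≡ 2 × r ≡ 1 × s ≡ 2) ⊎ (a ≡ 2 × b ≡ 3 × r ≡ 2 × s ≡ 1)

exceptionalParameters? : ∀ a b r s → Dec (ExceptionalParameters a b r s)
exceptionalParameters? a b r s =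
  ((a ℕ.≟ 3) ×-dec (b ℕ.≟ 2) ×-dec (r ℕ.≟ 1) ×-dec (s ℕ.≟ 2)) ⊎-dec
  ((a ℕ.≟ 2) ×-dec (b ℕ.≟ 3) ×-dec (r ℕ.≟ 2) ×-dec (s ℕ.≟ 1))

ExceptionalTriple : (a b c r s X Y x y : ℕ) → Set
ExceptionalTriple a b c r s X Y x y =
  ExceptionalParameters a b r s × c ≡ 7 × X ≡ 2 × Y ≡ 2 × x ≡ 1 × y ≡ 1

exceptionalTriple? : ∀ a b c r s X Y x y → Dec (ExceptionalTriple a b c r s X Y x y)
exceptionalTriple? a b c r s X Y x y =
  exceptionalParameters? a b r s ×-dec (c ℕ.≟ 7) ×-dec (X ℕ.≟ 2) ×-dec (Y ℕ.≟ 2) ×-dec (x ℕ.≟ 1) ×-dec (y ℕ.≟ 1)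

SmallTriplesAreExceptional : Set
SmallTriplesAreExceptional =
  ∀ {a} → a < 6 → 2 ≤ a → ∀ {x} → x < 3 → 1 ≤ x → a ^ x ≤ 5 → ∀ {X} → X < 4 → x < X → a ^ X ≤ 10 →
  ∀ {b} → b < 25 → 2 ≤ b → ∀ {y} → y < 5 → 1 ≤ y → b ^ y ≤ 24 → ∀ {Y} → Y < 4 → 1 ≤ Y → b ^ Y ≤ 15 →
  ∀ {r} → r < 4 → 1 ≤ r → ∀ {s} → s < 4 → 1 ≤ s → ∀ {c} → c < 49 →
  IsSolution a b c r s 0 Y → IsSolution a b c r s X 0 → IsSolution a b c r s x y →
  ExceptionalTriple a b c r s X Y x y

-- The bounds are those of SmallParameters; c ≤ r + s B ≤ 48 by IsSolution⇒c≤.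
small-triples-are-exceptional : SmallTriplesAreExceptional
small-triples-are-exceptional = toWitness {a? = decide} _
  where
  decide : Dec SmallTriplesAreExceptional
  decide =
    allUpTo? (λ a → 2 ≤? a →-dec
      allUpTo? (λ x → 1 ≤? x →-dec a ^ x ≤? 5 →-dec
        allUpTo? (λ X → x <? X →-dec a ^ X ≤? 10 →-dec
          allUpTo? (λ b → 2 ≤? b →-dec
            allUpTo? (λ y → 1 ≤? y →-dec b ^ y ≤? 24 →-dec
              allUpTo? (λ Y → 1 ≤? Y →-dec b ^ Y ≤? 15 →-dec
                allUpTo? (λ r → 1 ≤? r →-dec
                  allUpTo? (λ s → 1 ≤? s →-dec
                    allUpTo? (λ c →
                      isSolution? a b c r s 0 Y →-dec isSolution? a b c r s X 0 →-dec isSolution? a b c r s x y →-dec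
                      exceptionalTriple? a b c r s X Y x y) 49) 4) 4) 4) 5) 25) 4) 3) 6

-- Three solutions with x < X

small-powers : ∀ {a b c r s X Y x y} → 2 ≤ a → 2 ≤ b → 1 ≤ r → 1 ≤ s →
  Coprime r (s * b) → Coprime s (r * a) →
  IsSolution a b c r s 0 Y → IsSolution a b c r s X 0 → IsSolution a b c r s x y →
  1 ≤ Y → 1 ≤ y → 1 ≤ x → x < X → SmallParameters (a ^ x) (a ^ X) (b ^ y) (b ^ Y) r s
small-powers {a} {b} {c} {r} {s} {X} {Y} {x} {y} 2≤a 2≤b 1≤r 1≤s r⊥sb s⊥ra sol₁ sol₂ sol₃ 1≤Y 1≤y 1≤x x<X =
  small-parameters (2≤m^n 2≤a 1≤x) (^-split a (<⇒≤ x<X)) (2≤m^n 2≤a (m<n⇒0<n∸m x<X))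
    (2≤m^n 2≤b 1≤y) (2≤m^n 2≤b 1≤Y) 1≤r 1≤s
    (coprime-*ˡ {o = a} s⊥ra) (Coprime.sym (coprime-^ (coprime-*ʳ {n = r} s⊥ra) x)) 2∣aˣ-if v∣B⊎B∣v
    (solutions-Balance {x = 0} {Y} {x} {y} sol₁ sol₃) (solutions-Balance {x = 0} {Y} {X} {0} sol₁ sol₂)
    (solutions-Balance {x = X} {0} {x} {y} sol₂ sol₃)
  where
  2∣aˣ-if : a ^ (X ∸ x) ≡ 2 → 2 ∣ a ^ x
  2∣aˣ-if aᵏ≡2 = subst (λ z → 2 ∣ z ^ x) (sym (m^n≡2⇒m≡2 (X ∸ x) 2≤a aᵏ≡2)) (2∣2^n 1≤x)
  v∣B⊎B∣v : (b ^ y ∣ b ^ Y × Coprime (b ^ y) r × (b ^ Y ≡ 2 * b ^ y → 2 ∣ b ^ y))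
          ⊎ (b ^ Y ∣ b ^ y × Coprime (b ^ Y) r)
  v∣B⊎B∣v with y ≤? Y
  ... | yes y≤Y = inj₁ (divides (b ^ (Y ∸ y)) (trans (^-split b y≤Y) (*-comm (b ^ y) _)) ,
                        Coprime.sym (coprime-^ (coprime-*ʳ {n = s} r⊥sb) y) , 2∣bʸ-if)
    where
    2∣bʸ-if : b ^ Y ≡ 2 * b ^ y → 2 ∣ b ^ y
    2∣bʸ-if bʸ≡2bʸ = subst (λ z → 2 ∣ z ^ y) (sym (m^n≡2⇒m≡2 (Y ∸ y) 2≤b bᵏ≡2)) (2∣2^n 1≤y)
      where
      bᵏ≡2 : b ^ (Y ∸ y) ≡ 2
      bᵏ≡2 = *-cancelˡ-≡ (b ^ (Y ∸ y)) 2 (b ^ y) {{m^n≢0 b y {{>-nonZero (≤-trans (s≤s z≤n) 2≤b)}}}}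
               (trans (sym (^-split b y≤Y)) (trans bʸ≡2bʸ (*-comm 2 (b ^ y))))
  ... | no y≰Y = inj₂ (divides (b ^ (y ∸ Y)) (trans (^-split b Y≤y) (*-comm (b ^ Y) _)) ,
                       Coprime.sym (coprime-^ (coprime-*ʳ {n = s} r⊥sb) Y))
    where
    Y≤y = <⇒≤ (≰⇒> y≰Y)

exceptional-triple : ∀ {a b c r s X Y x y} → 2 ≤ a → 2 ≤ b → 1 ≤ r → 1 ≤ s →
  Coprime r (s * b) → Coprime s (r * a) →
  IsSolution a b c r s 0 Y → IsSolution a b c r s X 0 → IsSolution a b c r s x y →
  1 ≤ Y → 1 ≤ y → 1 ≤ x → x < X → ExceptionalTriple a b c r s X Y x y
exceptional-triple {a} {b} {c} {r} {s} {X} {Y} {x} {y} 2≤a 2≤b 1≤r 1≤s r⊥sb s⊥ra sol₁ sol₂ sol₃ 1≤Y 1≤y 1≤x x<X =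
  small-triples-are-exceptional
    (s≤s (≤-trans (m≤m^n a {{>-nonZero (≤-trans (s≤s z≤n) 2≤a)}} 1≤x) u≤5)) 2≤a
    (s≤s (^-≤-exponent 2 2≤a u≤5 (m≤m+n 6 2))) 1≤x u≤5
    (s≤s (^-≤-exponent 3 2≤a A≤10 (m≤m+n 11 5))) x<X A≤10
    (s≤s (≤-trans (m≤m^n b {{>-nonZero (≤-trans (s≤s z≤n) 2≤b)}} 1≤y) v≤24)) 2≤b
    (s≤s (^-≤-exponent 4 2≤b v≤24 (m≤m+n 25 7))) 1≤y v≤24
    (s≤s (^-≤-exponent 3 2≤b B≤15 ≤-refl)) 1≤Y B≤15
    (s≤s r≤3) 1≤r (s≤s s≤3) 1≤s (s≤s c≤48) sol₁ sol₂ sol₃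
  where
  open SmallParameters (small-powers 2≤a 2≤b 1≤r 1≤s r⊥sb s⊥ra sol₁ sol₂ sol₃ 1≤Y 1≤y 1≤x x<X)
  c≤48 : c ≤ 48
  c≤48 = ≤-trans (IsSolution⇒c≤ {a} {b} {c} {r} {s} {0} {Y} sol₁)
                 (+-mono-≤ (≤-trans (≤-reflexive (*-identityʳ r)) r≤3) (*-mono-≤ s≤3 B≤15))

ExceptionalTriple-swap : ∀ {a b c r s X Y x y} →
  ExceptionalTriple b a c s r Y X y x → ExceptionalTriple a b c r s X Y x y
ExceptionalTriple-swap (inj₁ (b≡3 , a≡2 , s≡1 , r≡2) , c≡7 , Y≡2 , X≡2 , y≡1 , x≡1) =
  inj₂ (a≡2 , b≡3 , r≡2 , s≡1) , c≡7 , X≡2 , Y≡2 , x≡1 , y≡1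
ExceptionalTriple-swap (inj₂ (b≡2 , a≡3 , s≡2 , r≡1) , c≡7 , Y≡2 , X≡2 , y≡1 , x≡1) =
  inj₁ (a≡3 , b≡2 , r≡1 , s≡2) , c≡7 , X≡2 , Y≡2 , x≡1 , y≡1

SolutionSet-associate : ∀ {a b c r s N x y} → SolutionSet a b c r s N x y → SolutionSet b a c s r N y x
SolutionSet-associate {a} {b} {c} {r} {s} {x = x} {y} S = record
  { a>1 = b>1 ; b>1 = a>1 ; c>0 = c>0 ; r>0 = s>0 ; s>0 = r>0 ; N>2 = N>2
  ; solutions = λ i → IsSolution-swap {a} {b} {c} {r} {s} {x i} {y i} (solutions i)
  ; distinct  = λ i j yᵢ≡yⱼ xᵢ≡xⱼ → distinct i j xᵢ≡xⱼ yᵢ≡yⱼ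
  }
  where open SolutionSet S

BasicForm-associate : ∀ {a b c r s N x y} → BasicForm a b c r s N x y → BasicForm b a c s r N y x
BasicForm-associate F = record
  { gcd-r-sb = gcd-s-ra ; gcd-s-ra = gcd-r-sb ; min-x = min-y ; min-y = min-x
  ; a-not-pp = b-not-pp ; b-not-pp = a-not-pp
  }
  where open BasicForm F

exceptional-triple-of-set : ∀ {a b c r s N x y} → SolutionSet a b c r s N x y → BasicForm a b c r s N x y →
  ∀ {i₀ i₁ i} → x i₀ ≡ 0 → y i₁ ≡ 0 → 0 < y i₀ → 0 < x i → 0 < y i → x i < x i₁ →
  ExceptionalTriple a b c r s (x i₁) (y i₀) (x i) (y i)
exceptional-triple-of-set {a} {b} {c} {r} {s} {x = x} {y} S F {i₀} {i₁} {i}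
  xᵢ₀≡0 yᵢ₁≡0 0<yᵢ₀ 0<xᵢ 0<yᵢ xᵢ<xᵢ₁ =
  exceptional-triple a>1 b>1 r>0 s>0 (gcd≡1⇒coprime gcd-r-sb) (gcd≡1⇒coprime gcd-s-ra)
    (subst (λ z → IsSolution a b c r s z (y i₀)) xᵢ₀≡0 (solutions i₀))
    (subst (IsSolution a b c r s (x i₁)) yᵢ₁≡0 (solutions i₁))
    (solutions i) 0<yᵢ₀ 0<yᵢ 0<xᵢ xᵢ<xᵢ₁
  where
  open SolutionSet S
  open BasicForm F

-- The exceptional set of solutions

no-large-solution : ∀ {a b r s X Y} → ExceptionalParameters a b r s → IsSolution a b 7 r s X Y →
  3 ≤ X → 3 ≤ Y → ⊥
no-large-solution {X = X} {Y} (inj₁ (refl , refl , refl , refl)) (e , d , eq) 3≤X 3≤Y =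
  7≢3^m±2^[1+n] X Y 3≤X 3≤Y
    (subst (λ z → SumOrDiff 7 z (2 * 2 ^ Y)) (*-identityˡ (3 ^ X)) (signed-sum-SumOrDiff e d _ _ 7 eq))
no-large-solution {X = X} {Y} (inj₂ (refl , refl , refl , refl)) (e , d , eq) 3≤X 3≤Y =
  7≢3^m±2^[1+n] Y X 3≤Y 3≤X
    (subst (λ z → SumOrDiff 7 z (2 * 2 ^ X)) (*-identityˡ (3 ^ Y)) (SumOrDiff-sym (signed-sum-SumOrDiff e d _ _ 7 eq)))

Fin-unique⇒≡1 : ∀ {n} (k : Fin n) → (∀ k′ → k′ ≡ k) → n ≡ 1
Fin-unique⇒≡1 {suc zero}    zero    _      = refl
Fin-unique⇒≡1 {suc (suc n)} zero    all≡k with all≡k (suc zero)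
... | ()
Fin-unique⇒≡1 {suc (suc n)} (suc k) all≡k with all≡k zero
... | ()

≢1,2⇒≥3 : ∀ {z} → 1 ≤ z → z ≢ 1 → z ≢ 2 → 3 ≤ z
≢1,2⇒≥3 {1}                   _ z≢1 _   = ⊥-elim (z≢1 refl)
≢1,2⇒≥3 {2}                   _ _   z≢2 = ⊥-elim (z≢2 refl)
≢1,2⇒≥3 {suc (suc (suc z))} _ _   _   = s≤s (s≤s (s≤s z≤n))

exceptional-set : ∀ {a b c r s n} (x y : Fin (suc (suc n)) → ℕ) →
  SolutionSet a b c r s (suc (suc n)) x y → x zero ≡ 0 → y (suc zero) ≡ 0 →
  (∀ i → i ≢ zero → 0 < x i) → (∀ (k : Fin n) → 0 < y (suc (suc k))) →
  (∀ i j → i ≢ zero → j ≢ zero → x i ≡ x j → i ≡ j) →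
  (∀ i j → i ≢ suc zero → j ≢ suc zero → y i ≡ y j → i ≡ j) →
  (k : Fin n) → ExceptionalTriple a b c r s (x (suc zero)) (y zero) (x (suc (suc k))) (y (suc (suc k))) →
  Exceptional a b c r s (suc (suc n)) x y
exceptional-set {a} {b} {c} {r} {s} {n} x y S x₀≡0 y₁≡0 x>0 y>0 x-inj y-inj k
  (params , c≡7 , x₁≡2 , y₀≡2 , xₖ≡1 , yₖ≡1) =
  with-c params , cong (λ m → suc (suc m)) (Fin-unique⇒≡1 k unique) , pairs , covered
  where
  with-c : ExceptionalParameters a b r s →
    (a ≡ 3 × b ≡ 2 × c ≡ 7 × r ≡ 1 × s ≡ 2) ⊎ (a ≡ 2 × b ≡ 3 × c ≡ 7 × r ≡ 2 × s ≡ 1)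
  with-c (inj₁ (a≡ , b≡ , r≡ , s≡)) = inj₁ (a≡ , b≡ , c≡7 , r≡ , s≡)
  with-c (inj₂ (a≡ , b≡ , r≡ , s≡)) = inj₂ (a≡ , b≡ , c≡7 , r≡ , s≡)
  unique : ∀ k′ → k′ ≡ k
  unique k′ with k′ Fin.≟ k
  ... | yes k′≡k = k′≡k
  ... | no k′≢k = ⊥-elim (no-large-solution params
          (subst (λ z → IsSolution a b z r s (x j) (y j)) c≡7 (SolutionSet.solutions S j))
          (≢1,2⇒≥3 (x>0 j λ ()) xⱼ≢1 xⱼ≢2) (≢1,2⇒≥3 (y>0 k′) yⱼ≢1 yⱼ≢2))
    where
    j = suc (suc k′)
    xⱼ≢1 : x j ≢ 1
    xⱼ≢1 xⱼ≡1 = k′≢k (Fin.suc-injective (Fin.suc-injective (x-inj _ _ (λ ()) (λ ()) (trans xⱼ≡1 (sym xₖ≡1)))))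
    xⱼ≢2 : x j ≢ 2
    xⱼ≢2 xⱼ≡2 with x-inj j (suc zero) (λ ()) (λ ()) (trans xⱼ≡2 (sym x₁≡2))
    ... | ()
    yⱼ≢1 : y j ≢ 1
    yⱼ≢1 yⱼ≡1 = k′≢k (Fin.suc-injective (Fin.suc-injective (y-inj _ _ (λ ()) (λ ()) (trans yⱼ≡1 (sym yₖ≡1)))))
    yⱼ≢2 : y j ≢ 2
    yⱼ≢2 yⱼ≡2 with y-inj j zero (λ ()) (λ ()) (trans yⱼ≡2 (sym y₀≡2))
    ... | ()
  pairs : ∀ i → InExceptionalPairs (x i) (y i)
  pairs zero             = inj₁ (x₀≡0 , y₀≡2)
  pairs (suc zero)       = inj₂ (inj₁ (x₁≡2 , y₁≡0))
  pairs (suc (suc k′)) rewrite unique k′ = inj₂ (inj₂ (xₖ≡1 , yₖ≡1))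
  covered : ∀ p q → InExceptionalPairs p q → ∃ λ i → x i ≡ p × y i ≡ q
  covered _ _ (inj₁ (refl , refl))        = zero , x₀≡0 , y₀≡2
  covered _ _ (inj₂ (inj₁ (refl , refl))) = suc zero , x₁≡2 , y₁≡0
  covered _ _ (inj₂ (inj₂ (refl , refl))) = suc (suc k) , xₖ≡1 , yₖ≡1

beyond-first-two : ∀ {n} (i : Fin (suc (suc n))) → i ≢ zero → i ≢ suc zero → ∃ λ k → i ≡ suc (suc k)
beyond-first-two zero           i≢0 _   = ⊥-elim (i≢0 refl)
beyond-first-two (suc zero)     _   i≢1 = ⊥-elim (i≢1 refl)
beyond-first-two (suc (suc k)) _   _   = k , refl

≤-all-or-<-any : ∀ {m} (f : Fin m → ℕ) (i₀ j : Fin m) →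
  (∀ i → i ≢ i₀ → f j ≤ f i) ⊎ ∃ λ i → i ≢ i₀ × f i < f j
≤-all-or-<-any f i₀ j with Fin.any? (λ i → ¬? (i Fin.≟ i₀) ×-dec (f i <? f j))
... | yes (i , i≢i₀ , fᵢ<fⱼ) = inj₂ (i , i≢i₀ , fᵢ<fⱼ)
... | no ∄                  = inj₁ λ i i≢i₀ → ≮⇒≥ λ fᵢ<fⱼ → ∄ (i , i≢i₀ , fᵢ<fⱼ)

lemma9 : (a b c r s n : ℕ) (x y : Fin (suc (suc n)) → ℕ) →
    SolutionSet a b c r s (suc (suc n)) x y →
    BasicForm a b c r s (suc (suc n)) x y →
    x zero ≡ 0 → y (suc zero) ≡ 0 →
    (∀ i → i ≢ zero → 0 < x i) →
    0 < y zero →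
    (∀ (k : Fin n) → 0 < y (suc (suc k))) →
    (∀ i j → i ≢ zero → j ≢ zero → x i ≡ x j → i ≡ j) →
    (∀ i j → i ≢ suc zero → j ≢ suc zero → y i ≡ y j → i ≡ j) →
    ((∀ i → i ≢ zero → x (suc zero) ≤ x i) × (∀ i → i ≢ suc zero → y zero ≤ y i))
    ⊎ Exceptional a b c r s (suc (suc n)) x y
lemma9 a b c r s n x y S F x₀≡0 y₁≡0 x>0 y₀>0 y>0 x-inj y-inj
  with ≤-all-or-<-any x zero (suc zero) | ≤-all-or-<-any y (suc zero) zero
... | inj₁ x₁-min | inj₁ y₀-min = inj₁ (x₁-min , y₀-min)
... | inj₂ (i , i≢0 , xᵢ<x₁) | _ with beyond-first-two i i≢0 (λ { refl → <-irrefl refl xᵢ<x₁ })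
...   | k , refl = inj₂ (exceptional-set x y S x₀≡0 y₁≡0 x>0 y>0 x-inj y-inj k
                     (exceptional-triple-of-set S F x₀≡0 y₁≡0 y₀>0 (x>0 _ i≢0) (y>0 k) xᵢ<x₁))
lemma9 a b c r s n x y S F x₀≡0 y₁≡0 x>0 y₀>0 y>0 x-inj y-inj
  | inj₁ _ | inj₂ (i , i≢1 , yᵢ<y₀) with beyond-first-two i (λ { refl → <-irrefl refl yᵢ<y₀ }) i≢1
...   | k , refl = inj₂ (exceptional-set x y S x₀≡0 y₁≡0 x>0 y>0 x-inj y-inj k
                     (ExceptionalTriple-swap (exceptional-triple-of-set (SolutionSet-associate S) (BasicForm-associate F)
                        y₁≡0 x₀≡0 (x>0 (suc zero) λ ()) (y>0 k) (x>0 _ λ ()) yᵢ<y₀)))
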